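{- Let $d\ge2$. The set of normalized distances between two points of $\mathscr C_d$ equals \[ \mathcal D(\mathscr C_d)=\left\{\frac{\sqrt{(d+1)x(d+1-x)}}{d^{3/2}}:\ x\in\mathbb Z,\ 0\le x\le\left\lfloor\tfrac{d+1}{2}\right\rfloor\right\}, \] and $\mathcal D(\mathscr C_d)$ becomes dense in $[0,1/2]$ as $d\to\infty$: for every $y\in[0,1/2]$ and every $\varepsilon>0$, for all sufficiently large $d$ there is an element of $\mathcal D(\mathscr C_d)$ in $(y-\varepsilon,y+\varepsilon)$.
   Context: For $d\ge2$, $\mathscr C_d=\{\mathfrak c_0,\dots,\mathfrak c_d\}\subset\mathbb Z^{d+1}$, where $\mathfrak c_h=(r(h),r(h+1),\dots,r(h+d))$ and $r(m)\in\{0,\dots,d\}$ is the residue of $m$ modulo $d+1$ (the rows of the circulant matrix with first row $(0,1,\dots,d)$). The normalized distance between two points of $\mathscr C_d$ is their Euclidean distance divided by $d^{3/2}$.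
   Formalization: In the density claim, the point y and the tolerance ε range only over the rationals. -}

module Defs where

open import Data.Nat using (ℕ; suc; _+_; _*_; _^_; ∣_-_∣; _%_)
open import Data.Fin using (Fin; toℕ)
open import Data.List using (map; allFin)
open import Data.Nat.ListAction using (sum)
open import Data.Integer using (+_)
open import Data.Product using (_×_)
open import Data.Sum using (_⊎_)
import Data.Rational as ℚ
open ℚ using (ℚ; 0ℚ)

-- The point 𝔠_h of 𝒞_d: its k-th coordinate (k = 0..d) is r(h+k) = (h+k) mod (d+1).
𝔠 : (d : ℕ) → Fin (suc d) → Fin (suc d) → ℕ
𝔠 d h k = (toℕ h + toℕ k) % (suc d)

sqDist : (d : ℕ) → Fin (suc d) → Fin (suc d) → ℕ
sqDist d h g = sum (map (λ k → ∣ 𝔠 d h k - 𝔠 d g k ∣ ^ 2) (allFin (suc d)))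

ℕ→ℚ : ℕ → ℚ
ℕ→ℚ n = + n ℚ./ 1

-- "sqrt v / d^{3/2} ∈ (y - ε, y + ε)", written without square roots:
--   sqrt v / d^{3/2} < y + ε   ⇔  v < (y+ε)² d³          (when y + ε > 0)
--   y - ε < sqrt v / d^{3/2}   ⇔  y - ε < 0  or  (y-ε)² d³ < v
InWindow : (d v : ℕ) (y ε : ℚ) → Set
InWindow d v y ε =
  (ℕ→ℚ v ℚ.< ((y ℚ.+ ε) ℚ.* (y ℚ.+ ε)) ℚ.* ℕ→ℚ (d ^ 3))
  × ((y ℚ.- ε ℚ.< 0ℚ) ⊎ (((y ℚ.- ε) ℚ.* (y ℚ.- ε)) ℚ.* ℕ→ℚ (d ^ 3) ℚ.< ℕ→ℚ v))

-- The point 𝔠_g is 𝔠_h shifted cyclically by t = g − h, so after rotating the summation index the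
-- squared distance is Σ_{j<n} (j mod n − (j + t) mod n)² with n = d + 1: the n − t coordinates that do
-- not wrap around contribute t² each and the t that do contribute (n − t)² each, giving n t (n − t).
-- Replacing t by n − t leaves this unchanged, so t may be taken ≤ ⌊n/2⌋.
--
-- For density, n x (n − x) grows from 0 at x = 0 to at least d³/4 at x = ⌊n/2⌋ in steps of at most
-- n² < 4d², while the window ((y − ε)² d³, (y + ε)² d³) of squared distances has length
-- 4 y ε d³ ≥ 4 ε² d³ ≥ 4d² once ε² d ≥ 1 and y ≥ ε. Hence the sequence cannot jump over the window;
-- if y < ε, the value at x = 0 already lies in it.

module Submission where

open import Defs
open import Function using (_∘_)
open import Function.Bundles using (_⇔_; mk⇔)
open import Data.Nat
  using (ℕ; zero; suc; _+_; _*_; _∸_; _/_; _%_; _^_; ∣_-_∣; _≤_; _<_; z≤n; s≤s; s≤s⁻¹; z<s; NonZero; >-nonZero)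
open import Data.Nat.Properties
open import Data.Nat.DivMod using (m<n⇒m%n≡m; [m+n]%n≡m%n; m≡m%n+[m/n]*n; m%n<n; m/n<m)
open import Data.Nat.Tactic.RingSolver using (solve-∀)
import Data.Nat.Coprimality as C
open import Algebra.Properties.CommutativeSemigroup +-commutativeSemigroup using (xy∙z≈y∙xz; xy∙z≈xz∙y)
import Algebra.Properties.CommutativeSemigroup *-commutativeSemigroup as *-CS
open import Data.Fin as Fin using (Fin; toℕ; fromℕ<)
open import Data.Fin.Properties using (toℕ<n; toℕ-fromℕ<)
open import Data.List using (map; allFin; tabulate)
open import Data.List.Properties using (map-tabulate; map-cong)
open import Data.Nat.ListAction using (sum)
open import Data.Integer as ℤ using (+[1+_])
import Data.Integer.Properties as ℤP
open import Data.Integer.Tactic.RingSolver using () renaming (solve-∀ to ℤ-solve-∀)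
import Data.Rational as ℚ
open ℚ using (ℚ; 0ℚ; 1ℚ; ½; Positive; mkℚ; toℚᵘ) renaming (_≤_ to _≤ℚ_)
import Data.Rational.Properties as ℚP
import Data.Rational.Unnormalised as ℚᵘ
open ℚᵘ using (mkℚᵘ)
import Data.Rational.Unnormalised.Properties as ℚᵘP
open import Data.Rational.Solver using (module +-*-Solver)
open +-*-Solver using (solve; _:+_; _:*_; _:-_; _:=_; con)
open import Data.Product using (_×_; _,_; ∃-syntax)
open import Data.Sum using (inj₁; inj₂)
open import Relation.Binary.PropositionalEquality
open import Relation.Nullary using (yes; no)

∑< : (ℕ → ℕ) → ℕ → ℕ
∑< f zero    = 0
∑< f (suc n) = f 0 + ∑< (f ∘ suc) n

sum-allFin : ∀ n (f : ℕ → ℕ) → sum (map (f ∘ toℕ) (allFin n)) ≡ ∑< f n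
sum-allFin n f = trans (cong sum (map-tabulate {n = n} (λ k → k) (f ∘ toℕ))) (sum-tabulate n f)
  where
  sum-tabulate : ∀ n (f : ℕ → ℕ) → sum (tabulate {n = n} (f ∘ toℕ)) ≡ ∑< f n
  sum-tabulate zero    f = refl
  sum-tabulate (suc n) f = cong (f 0 +_) (sum-tabulate n (f ∘ suc))

∑<-cong : ∀ n {f g : ℕ → ℕ} → (∀ k → f k ≡ g k) → ∑< f n ≡ ∑< g n
∑<-cong zero    f≗g = refl
∑<-cong (suc n) f≗g = cong₂ _+_ (f≗g 0) (∑<-cong n (f≗g ∘ suc))

∑<-const : ∀ n {f : ℕ → ℕ} {c} → (∀ k → k < n → f k ≡ c) → ∑< f n ≡ n * c
∑<-const zero    f≡c = refl
∑<-const (suc n) f≡c = cong₂ _+_ (f≡c 0 z<s) (∑<-const n (λ k k<n → f≡c (suc k) (s≤s k<n)))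

∑<-+ : ∀ m n (f : ℕ → ℕ) → ∑< f (m + n) ≡ ∑< f m + ∑< (λ k → f (m + k)) n
∑<-+ zero    n f = refl
∑<-+ (suc m) n f = trans (cong (f 0 +_) (∑<-+ m n (f ∘ suc))) (sym (+-assoc (f 0) _ _))

∑<-last : ∀ n (f : ℕ → ℕ) → ∑< f (suc n) ≡ ∑< f n + f n
∑<-last zero    f = +-identityʳ (f 0)
∑<-last (suc n) f = trans (cong (f 0 +_) (∑<-last n (f ∘ suc))) (sym (+-assoc (f 0) _ _))

∑<-shift : ∀ n (f : ℕ → ℕ) → f n ≡ f 0 → ∑< (f ∘ suc) n ≡ ∑< f n
∑<-shift n f fn≡f0 = +-cancelˡ-≡ (f 0) _ _ (begin
    f 0 + ∑< (f ∘ suc) n  ≡⟨ ∑<-last n f ⟩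
    ∑< f n + f n          ≡⟨ cong (∑< f n +_) fn≡f0 ⟩
    ∑< f n + f 0          ≡⟨ +-comm (∑< f n) (f 0) ⟩
    f 0 + ∑< f n          ∎)
  where open ≡-Reasoning

∑<-rotate : ∀ n {f : ℕ → ℕ} → (∀ j → f (n + j) ≡ f j) →
            ∀ a → ∑< (λ k → f (a + k)) n ≡ ∑< f n
∑<-rotate n {f} periodic zero    = refl
∑<-rotate n {f} periodic (suc a) = begin
    ∑< (λ k → f (suc a + k)) n      ≡⟨ ∑<-cong n (λ k → cong f (sym (+-suc a k))) ⟩
    ∑< (λ k → f (a + suc k)) n      ≡⟨ ∑<-shift n (λ k → f (a + k)) wraps ⟩
    ∑< (λ k → f (a + k)) n          ≡⟨ ∑<-rotate n periodic a ⟩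
    ∑< f n                          ∎
  where
  open ≡-Reasoning
  wraps : f (a + n) ≡ f (a + 0)
  wraps = trans (cong f (+-comm a n)) (trans (periodic a) (cong f (sym (+-identityʳ a))))

rowGap : (n : ℕ) .{{_ : NonZero n}} → ℕ → ℕ → ℕ
rowGap n t j = ∣ j % n - (j + t) % n ∣ ^ 2

rowGap-periodic : ∀ n .{{_ : NonZero n}} t j → rowGap n t (n + j) ≡ rowGap n t j
rowGap-periodic n t j =
  cong₂ (λ a b → ∣ a - b ∣ ^ 2) (n+i%n≡i%n j) (trans (cong (_% n) (+-assoc n j t)) (n+i%n≡i%n (j + t)))
  where
  n+i%n≡i%n : ∀ i → (n + i) % n ≡ i % n
  n+i%n≡i%n i = trans (cong (_% n) (+-comm n i)) ([m+n]%n≡m%n i n)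

∑<-rowGap : ∀ n .{{_ : NonZero n}} u t → u + t ≡ n → ∑< (rowGap n t) n ≡ n * t * u
∑<-rowGap .(u + t) u t refl = begin
    ∑< (rowGap n t) (u + t)                                 ≡⟨ ∑<-+ u t (rowGap n t) ⟩
    ∑< (rowGap n t) u + ∑< (λ i → rowGap n t (u + i)) t     ≡⟨ cong₂ _+_ (∑<-const u unwrapped) (∑<-const t wrapped) ⟩
    u * t ^ 2 + t * u ^ 2                                   ≡⟨ collect u t ⟩
    (u + t) * t * u                                         ∎
  where
  open ≡-Reasoning
  n : ℕ
  n = u + t
  collect : ∀ u t → u * (t * (t * 1)) + t * (u * (u * 1)) ≡ (u + t) * t * u
  collect = solve-∀
  unwrapped : ∀ k → k < u → rowGap n t k ≡ t ^ 2
  unwrapped k k<u = cong (_^ 2) (begin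
      ∣ k % n - (k + t) % n ∣  ≡⟨ cong₂ ∣_-_∣ (m<n⇒m%n≡m (≤-<-trans (m≤m+n k t) k+t<n)) (m<n⇒m%n≡m k+t<n) ⟩
      ∣ k - k + t ∣            ≡⟨ ∣m-m+n∣≡n k t ⟩
      t                        ∎)
    where
    k+t<n : k + t < n
    k+t<n = +-monoˡ-< t k<u
  wrapped : ∀ i → i < t → rowGap n t (u + i) ≡ u ^ 2
  wrapped i i<t = cong (_^ 2) (begin
      ∣ (u + i) % n - (u + i + t) % n ∣  ≡⟨ cong₂ ∣_-_∣ (m<n⇒m%n≡m (+-monoʳ-< u i<t)) u+i+t%n≡i ⟩
      ∣ u + i - i ∣                      ≡⟨ cong ∣_- i ∣ (+-comm u i) ⟩
      ∣ i + u - i ∣                      ≡⟨ ∣-∣-comm (i + u) i ⟩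
      ∣ i - i + u ∣                      ≡⟨ ∣m-m+n∣≡n i u ⟩
      u                                  ∎)
    where
    u+i+t%n≡i : (u + i + t) % n ≡ i
    u+i+t%n≡i = begin
      (u + i + t) % n  ≡⟨ cong (_% n) (xy∙z≈y∙xz u i t) ⟩
      (i + n) % n      ≡⟨ [m+n]%n≡m%n i n ⟩
      i % n            ≡⟨ m<n⇒m%n≡m (<-≤-trans i<t (m≤n+m t u)) ⟩
      i                ∎

sqDistAt : ℕ → ℕ → ℕ
sqDistAt n t = n * t * (n ∸ t)

sqDist-offset : ∀ d (h g : Fin (suc d)) t → toℕ g ≡ toℕ h + t → sqDist d h g ≡ sqDistAt (suc d) t
sqDist-offset d h g t g≡h+t = begin
    sqDist d h g
  ≡⟨ sum-allFin n (λ k → ∣ (a + k) % n - (toℕ g + k) % n ∣ ^ 2) ⟩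
    ∑< (λ k → ∣ (a + k) % n - (toℕ g + k) % n ∣ ^ 2) n
  ≡⟨ ∑<-cong n (λ k → cong (λ m → ∣ (a + k) % n - m % n ∣ ^ 2) (g+k≡a+k+t k)) ⟩
    ∑< (λ k → rowGap n t (a + k)) n
  ≡⟨ ∑<-rotate n (rowGap-periodic n t) a ⟩
    ∑< (rowGap n t) n
  ≡⟨ ∑<-rowGap n (n ∸ t) t (m∸n+n≡m t≤n) ⟩
    sqDistAt n t
  ∎
  where
  open ≡-Reasoning
  n a : ℕ
  n = suc d
  a = toℕ h
  g+k≡a+k+t : ∀ k → toℕ g + k ≡ a + k + t
  g+k≡a+k+t k = trans (cong (_+ k) g≡h+t) (xy∙z≈xz∙y a t k)
  t≤n : t ≤ n
  t≤n = ≤-trans (m≤n+m t a) (≤-trans (≤-reflexive (sym g≡h+t)) (<⇒≤ (toℕ<n g)))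

sqDist-sym : ∀ d (h g : Fin (suc d)) → sqDist d h g ≡ sqDist d g h
sqDist-sym d h g = cong sum (map-cong (λ k → cong (_^ 2) (∣-∣-comm (𝔠 d h k) (𝔠 d g k))) (allFin (suc d)))

sqDist-ordered : ∀ d (h g : Fin (suc d)) → toℕ h ≤ toℕ g → sqDist d h g ≡ sqDistAt (suc d) ∣ toℕ h - toℕ g ∣
sqDist-ordered d h g h≤g = sqDist-offset d h g _ (sym (begin
    toℕ h + ∣ toℕ h - toℕ g ∣  ≡⟨ cong (toℕ h +_) (∣-∣-comm (toℕ h) (toℕ g)) ⟩
    toℕ h + ∣ toℕ g - toℕ h ∣  ≡⟨ cong (toℕ h +_) (m≤n⇒∣n-m∣≡n∸m h≤g) ⟩
    toℕ h + (toℕ g ∸ toℕ h)    ≡⟨ m+[n∸m]≡n h≤g ⟩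
    toℕ g                      ∎))
  where open ≡-Reasoning

sqDist≡sqDistAt : ∀ d (h g : Fin (suc d)) → sqDist d h g ≡ sqDistAt (suc d) ∣ toℕ h - toℕ g ∣
sqDist≡sqDistAt d h g with ≤-total (toℕ h) (toℕ g)
... | inj₁ h≤g = sqDist-ordered d h g h≤g
... | inj₂ g≤h = begin
    sqDist d h g                          ≡⟨ sqDist-sym d h g ⟩
    sqDist d g h                          ≡⟨ sqDist-ordered d g h g≤h ⟩
    sqDistAt (suc d) ∣ toℕ g - toℕ h ∣  ≡⟨ cong (sqDistAt (suc d)) (∣-∣-comm (toℕ g) (toℕ h)) ⟩
    sqDistAt (suc d) ∣ toℕ h - toℕ g ∣  ∎
  where open ≡-Reasoning

sqDistAt-reflect : ∀ {n t} → t ≤ n → sqDistAt n (n ∸ t) ≡ sqDistAt n t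
sqDistAt-reflect {n} {t} t≤n =
  trans (cong (n * (n ∸ t) *_) (m∸[m∸n]≡n t≤n)) (*-CS.xy∙z≈xz∙y n (n ∸ t) t)

∸-≤-half : ∀ n {t} → n / 2 < t → n ∸ t ≤ n / 2
∸-≤-half n {t} n/2<t = m≤n+o⇒m∸n≤o n t (begin
    n                          ≡⟨ m≡m%n+[m/n]*n n 2 ⟩
    n % 2 + n / 2 * 2          ≤⟨ +-monoˡ-≤ (n / 2 * 2) (s≤s⁻¹ (m%n<n n 2)) ⟩
    1 + n / 2 * 2              ≡⟨ cong suc (*-comm (n / 2) 2) ⟩
    suc (n / 2) + (n / 2 + 0)  ≤⟨ +-mono-≤ n/2<t (≤-reflexive (+-identityʳ (n / 2))) ⟩
    t + n / 2                  ∎)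
  where open ≤-Reasoning

sqDistAt-fold : ∀ {n t} → t ≤ n → ∃[ x ] x ≤ n / 2 × sqDistAt n t ≡ sqDistAt n x
sqDistAt-fold {n} {t} t≤n with t ≤? n / 2
... | yes t≤n/2 = t , t≤n/2 , refl
... | no  t≰n/2 = n ∸ t , ∸-≤-half n (≰⇒> t≰n/2) , sym (sqDistAt-reflect t≤n)

∣toℕ-toℕ∣≤n : ∀ {n} (h g : Fin n) → ∣ toℕ h - toℕ g ∣ ≤ n
∣toℕ-toℕ∣≤n h g = ≤-trans (∣m-n∣≤m⊔n (toℕ h) (toℕ g)) (⊔-lub (<⇒≤ (toℕ<n h)) (<⇒≤ (toℕ<n g)))

sqDist-values : ∀ d s → (∃[ h ] ∃[ g ] sqDist d h g ≡ s) ⇔ (∃[ x ] x ≤ suc d / 2 × s ≡ sqDistAt (suc d) x)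
sqDist-values d s = mk⇔ to from
  where
  to : (∃[ h ] ∃[ g ] sqDist d h g ≡ s) → ∃[ x ] x ≤ suc d / 2 × s ≡ sqDistAt (suc d) x
  to (h , g , refl) with sqDistAt-fold (∣toℕ-toℕ∣≤n h g)
  ... | x , x≤n/2 , folded = x , x≤n/2 , trans (sqDist≡sqDistAt d h g) folded
  from : ∃[ x ] x ≤ suc d / 2 × s ≡ sqDistAt (suc d) x → ∃[ h ] ∃[ g ] sqDist d h g ≡ s
  from (x , x≤n/2 , refl) = Fin.zero , fromℕ< x<n , sqDist-offset d Fin.zero (fromℕ< x<n) x (toℕ-fromℕ< x<n)
    where
    x<n : x < suc d
    x<n = ≤-<-trans x≤n/2 (m/n<m (suc d) 2 (s≤s (s≤s z≤n)))

ℕ→ℚ-mkℚ : ∀ n → ℕ→ℚ n ≡ mkℚ (ℤ.+ n) 0 (C.sym (C.1-coprimeTo n))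
ℕ→ℚ-mkℚ n = ℚP.↥p/↧p≡p (mkℚ (ℤ.+ n) 0 (C.sym (C.1-coprimeTo n)))

toℚᵘ-ℕ→ℚ : ∀ n → toℚᵘ (ℕ→ℚ n) ≡ mkℚᵘ (ℤ.+ n) 0
toℚᵘ-ℕ→ℚ n = cong toℚᵘ (ℕ→ℚ-mkℚ n)

ℕ→ℚ-homo-+ : ∀ a b → ℕ→ℚ (a + b) ≡ ℕ→ℚ a ℚ.+ ℕ→ℚ b
ℕ→ℚ-homo-+ a b = ℚP.toℚᵘ-injective (begin
    toℚᵘ (ℕ→ℚ (a + b))                  ≡⟨ toℚᵘ-ℕ→ℚ (a + b) ⟩
    mkℚᵘ (ℤ.+ (a + b)) 0                 ≈⟨ ℚᵘ.*≡* (trans (cong (ℤ._* ℤ.1ℤ) (ℤP.pos-+ a b)) (over-1 (ℤ.+ a) (ℤ.+ b))) ⟩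
    mkℚᵘ (ℤ.+ a) 0 ℚᵘ.+ mkℚᵘ (ℤ.+ b) 0  ≡⟨ cong₂ ℚᵘ._+_ (toℚᵘ-ℕ→ℚ a) (toℚᵘ-ℕ→ℚ b) ⟨
    toℚᵘ (ℕ→ℚ a) ℚᵘ.+ toℚᵘ (ℕ→ℚ b)      ≈⟨ ℚP.toℚᵘ-homo-+ (ℕ→ℚ a) (ℕ→ℚ b) ⟨
    toℚᵘ (ℕ→ℚ a ℚ.+ ℕ→ℚ b)              ∎)
  where
  open ℚᵘP.≃-Reasoning
  over-1 : ∀ x y → (x ℤ.+ y) ℤ.* ℤ.1ℤ ≡ (x ℤ.* ℤ.1ℤ ℤ.+ y ℤ.* ℤ.1ℤ) ℤ.* ℤ.1ℤ
  over-1 = ℤ-solve-∀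

ℕ→ℚ-homo-* : ∀ a b → ℕ→ℚ (a * b) ≡ ℕ→ℚ a ℚ.* ℕ→ℚ b
ℕ→ℚ-homo-* a b = ℚP.toℚᵘ-injective (begin
    toℚᵘ (ℕ→ℚ (a * b))                  ≡⟨ toℚᵘ-ℕ→ℚ (a * b) ⟩
    mkℚᵘ (ℤ.+ (a * b)) 0                 ≈⟨ ℚᵘ.*≡* (cong (ℤ._* ℤ.1ℤ) (ℤP.pos-* a b)) ⟩
    mkℚᵘ (ℤ.+ a) 0 ℚᵘ.* mkℚᵘ (ℤ.+ b) 0  ≡⟨ cong₂ ℚᵘ._*_ (toℚᵘ-ℕ→ℚ a) (toℚᵘ-ℕ→ℚ b) ⟨
    toℚᵘ (ℕ→ℚ a) ℚᵘ.* toℚᵘ (ℕ→ℚ b)      ≈⟨ ℚP.toℚᵘ-homo-* (ℕ→ℚ a) (ℕ→ℚ b) ⟨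
    toℚᵘ (ℕ→ℚ a ℚ.* ℕ→ℚ b)              ∎)
  where open ℚᵘP.≃-Reasoning

ℕ→ℚ-mono-≤ : ∀ {a b} → a ≤ b → ℕ→ℚ a ℚ.≤ ℕ→ℚ b
ℕ→ℚ-mono-≤ {a} {b} a≤b rewrite ℕ→ℚ-mkℚ a | ℕ→ℚ-mkℚ b =
  ℚ.*≤* (subst₂ ℤ._≤_ (sym (ℤP.*-identityʳ (ℤ.+ a))) (sym (ℤP.*-identityʳ (ℤ.+ b))) (ℤ.+≤+ a≤b))

ℕ→ℚ-mono-< : ∀ {a b} → a < b → ℕ→ℚ a ℚ.< ℕ→ℚ b
ℕ→ℚ-mono-< {a} {b} a<b rewrite ℕ→ℚ-mkℚ a | ℕ→ℚ-mkℚ b =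
  ℚ.*<* (subst₂ ℤ._<_ (sym (ℤP.*-identityʳ (ℤ.+ a))) (sym (ℤP.*-identityʳ (ℤ.+ b))) (ℤ.+<+ a<b))

archimedean : ∀ ε → Positive ε → ∃[ k ] 1ℚ ℚ.≤ ε ℚ.* ℕ→ℚ k
archimedean ε@(mkℚ +[1+ a ] b _) _ =
  suc b , subst (1ℚ ℚ.≤_) (sym ε*[1+b]≡1+a) (ℕ→ℚ-mono-≤ {1} {suc a} (s≤s z≤n))
  where
  ε*[1+b]≡1+a : ε ℚ.* ℕ→ℚ (suc b) ≡ ℕ→ℚ (suc a)
  ε*[1+b]≡1+a = ℚP.toℚᵘ-injective (begin
      toℚᵘ (ε ℚ.* ℕ→ℚ (suc b))                 ≈⟨ ℚP.toℚᵘ-homo-* ε (ℕ→ℚ (suc b)) ⟩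
      toℚᵘ ε ℚᵘ.* toℚᵘ (ℕ→ℚ (suc b))           ≡⟨ cong (toℚᵘ ε ℚᵘ.*_) (toℚᵘ-ℕ→ℚ (suc b)) ⟩
      mkℚᵘ +[1+ a ] b ℚᵘ.* mkℚᵘ (ℤ.+ suc b) 0  ≈⟨ ℚᵘ.*≡* (cong +[1+_] (cancel a b)) ⟩
      mkℚᵘ (ℤ.+ suc a) 0                       ≡⟨ toℚᵘ-ℕ→ℚ (suc a) ⟨
      toℚᵘ (ℕ→ℚ (suc a))                       ∎)
    where
    open ℚᵘP.≃-Reasoning
    cancel : ∀ a b → (b + a * suc b) * 1 ≡ b * 1 + a * suc (b * 1)
    cancel = solve-∀

discrete-ivt : ∀ m (g : ℕ → ℚ) {L U} → g 0 ℚ.< U → L ℚ.< g m →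
               (∀ x → g x ℚ.≤ L → g (suc x) ℚ.< U) →
               ∃[ x ] x ≤ m × L ℚ.< g x × g x ℚ.< U
discrete-ivt zero    g g0<U L<gm jump = 0 , z≤n , L<gm , g0<U
discrete-ivt (suc m) g {L} g0<U L<gm jump with L ℚP.<? g 0
... | yes L<g0 = 0 , z≤n , L<g0 , g0<U
... | no  L≮g0 with discrete-ivt m (g ∘ suc) (jump 0 (ℚP.≮⇒≥ L≮g0)) L<gm (jump ∘ suc)
...   | x , x≤m , L<gx , gx<U = suc x , s≤s x≤m , L<gx , gx<U

square-mono-< : ∀ {p q} → 0ℚ ℚ.≤ p → p ℚ.< q → p ℚ.* p ℚ.< q ℚ.* q
square-mono-< {p} {q} 0≤p p<q = ℚP.≤-<-trans
  (ℚP.*-monoˡ-≤-nonNeg p {{ℚ.nonNegative 0≤p}} (ℚP.<⇒≤ p<q))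
  (ℚP.*-monoˡ-<-pos q {{ℚ.positive (ℚP.≤-<-trans 0≤p p<q)}} p<q)

sqDistAt-suc : ∀ n x → sqDistAt n (suc x) ≤ sqDistAt n x + n * n
sqDistAt-suc n x = begin
    n * suc x * (n ∸ suc x)                ≡⟨ expand n x (n ∸ suc x) ⟩
    n * ((n ∸ suc x) + x * (n ∸ suc x))    ≤⟨ *-monoʳ-≤ n (+-mono-≤ (m∸n≤m n (suc x)) (*-monoʳ-≤ x (∸-monoʳ-≤ n (n≤1+n x)))) ⟩
    n * (n + x * (n ∸ x))                  ≡⟨ regroup n x (n ∸ x) ⟩
    sqDistAt n x + n * n                   ∎
  where
  open ≤-Reasoning
  expand : ∀ n x k → n * suc x * k ≡ n * (k + x * k)
  expand = solve-∀
  regroup : ∀ n x k → n * (n + x * k) ≡ n * x * k + n * n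
  regroup = solve-∀

-- With n = suc d = r + 2q (r ∈ {0,1}) one has 4 q (n ∸ q) = n² − r, so the bound reads (n − 1)³ ≤ n (n² − r).
cube≤4*sqDistAt-half : ∀ d → d ^ 3 ≤ 4 * sqDistAt (suc d) (suc d / 2)
cube≤4*sqDistAt-half d =
  subst (λ k → d ^ 3 ≤ 4 * (suc d * q * k)) (sym n∸q≡r+q) (bound d q r n≡r+2q (s≤s⁻¹ (m%n<n (suc d) 2)))
  where
  q r : ℕ
  q = suc d / 2
  r = suc d % 2
  n≡r+2q : suc d ≡ r + q * 2
  n≡r+2q = m≡m%n+[m/n]*n (suc d) 2
  n∸q≡r+q : suc d ∸ q ≡ r + q
  n∸q≡r+q = trans (cong (_∸ q) (trans n≡r+2q (split r q))) (m+n∸n≡m (r + q) q)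
    where
    split : ∀ r q → r + q * 2 ≡ r + q + q
    split = solve-∀
  odd : ∀ q → let w = suc (q * 2) in
        4 * (suc w * suc q * (0 + suc q)) ≡ w * (w * (w * 1)) + (12 * (q * q) + 18 * q + 7)
  odd = solve-∀
  even : ∀ q → let w = q * 2 in
         4 * (suc w * q * (1 + q)) ≡ w * (w * (w * 1)) + (12 * (q * q) + 4 * q)
  even = solve-∀
  ≤-from-excess : ∀ {a b c} → b ≡ a + c → a ≤ b
  ≤-from-excess {a} {c = c} b≡a+c = subst (a ≤_) (sym b≡a+c) (m≤m+n a c)
  bound : ∀ d q r → suc d ≡ r + q * 2 → r ≤ 1 → d ^ 3 ≤ 4 * (suc d * q * (r + q))
  bound d zero    zero        () _
  bound d (suc q) zero        eq _ rewrite suc-injective eq = ≤-from-excess (odd q)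
  bound d q       (suc zero)  eq _ rewrite suc-injective eq = ≤-from-excess (even q)
  bound d q       (suc (suc r)) _ (s≤s ())

suc-square<4*square : ∀ d → 2 ≤ d → suc d * suc d < 4 * (d * d)
suc-square<4*square d 2≤d = subst (suc d * suc d <_) (double² d) (*-mono-< n<2d n<2d)
  where
  n<2d : suc d < d + d
  n<2d = +-monoˡ-< d 2≤d
  double² : ∀ d → (d + d) * (d + d) ≡ 4 * (d * d)
  double² = solve-∀

module Window {d : ℕ} (2≤d : 2 ≤ d) {y ε : ℚ} (0≤y : 0ℚ ℚ.≤ y) (0<ε : 0ℚ ℚ.< ε) where

  n : ℕ
  n = suc d

  D C U L : ℚ
  D = ℕ→ℚ d
  C = ℕ→ℚ (d ^ 3)
  U = (y ℚ.+ ε) ℚ.* (y ℚ.+ ε) ℚ.* C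
  L = (y ℚ.- ε) ℚ.* (y ℚ.- ε) ℚ.* C

  F : ℕ → ℚ
  F x = ℕ→ℚ (sqDistAt n x)

  C≡D³ : C ≡ D ℚ.* (D ℚ.* (D ℚ.* 1ℚ))
  C≡D³ = trans (ℕ→ℚ-homo-* d _) (cong (D ℚ.*_) (trans (ℕ→ℚ-homo-* d _) (cong (D ℚ.*_) (ℕ→ℚ-homo-* d 1))))

  instance
    ε-pos : Positive ε
    ε-pos = ℚ.positive 0<ε
    y+ε-pos : Positive (y ℚ.+ ε)
    y+ε-pos = ℚP.nonNeg+pos⇒pos y {{ℚ.nonNegative 0≤y}} ε
    C-pos : Positive C
    C-pos = ℚ.positive (ℕ→ℚ-mono-< {0} (m^n>0 d {{>-nonZero (≤-trans (s≤s z≤n) 2≤d)}} 3))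

  F0<U : F 0 ℚ.< U
  F0<U = subst (ℚ._< U) (sym F0≡0) (ℚP.positive⁻¹ U {{U-pos}})
    where
    U-pos : Positive U
    U-pos = ℚP.pos*pos⇒pos ((y ℚ.+ ε) ℚ.* (y ℚ.+ ε)) {{ℚP.pos*pos⇒pos (y ℚ.+ ε) (y ℚ.+ ε)}} C
    F0≡0 : F 0 ≡ 0ℚ
    F0≡0 = cong (λ k → ℕ→ℚ (k * (n ∸ 0))) (*-zeroʳ n)

  L<F-half : 0ℚ ℚ.≤ y ℚ.- ε → y ℚ.≤ ½ → L ℚ.< F (n / 2)
  L<F-half 0≤y-ε y≤½ = begin-strict
      (y ℚ.- ε) ℚ.* (y ℚ.- ε) ℚ.* C             <⟨ ℚP.*-monoˡ-<-pos C (square-mono-< 0≤y-ε y-ε<½) ⟩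
      ½ ℚ.* ½ ℚ.* C                             ≤⟨ ℚP.*-monoˡ-≤-nonNeg (½ ℚ.* ½) (ℕ→ℚ-mono-≤ (cube≤4*sqDistAt-half d)) ⟩
      ½ ℚ.* ½ ℚ.* ℕ→ℚ (4 * sqDistAt n (n / 2))  ≡⟨ cong (½ ℚ.* ½ ℚ.*_) (ℕ→ℚ-homo-* 4 (sqDistAt n (n / 2))) ⟩
      ½ ℚ.* ½ ℚ.* (ℕ→ℚ 4 ℚ.* F (n / 2))         ≡⟨ quarter-of-four (F (n / 2)) ⟩
      F (n / 2)                                 ∎
    where
    open ℚP.≤-Reasoning
    y-ε<½ : y ℚ.- ε ℚ.< ½
    y-ε<½ = ℚP.<-≤-trans (subst (y ℚ.- ε ℚ.<_) (ℚP.+-identityʳ y) (ℚP.+-monoʳ-< y (ℚP.neg-antimono-< 0<ε))) y≤½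
    quarter-of-four : ∀ p → ½ ℚ.* ½ ℚ.* (ℕ→ℚ 4 ℚ.* p) ≡ p
    quarter-of-four = solve 1 (λ p → con ½ :* con ½ :* (con (ℕ→ℚ 4) :* p) := p) refl

  L+n²<U : 0ℚ ℚ.≤ y ℚ.- ε → 1ℚ ℚ.≤ ε ℚ.* ε ℚ.* D → L ℚ.+ ℕ→ℚ (n * n) ℚ.< U
  L+n²<U 0≤y-ε 1≤ε²d = begin-strict
      L ℚ.+ ℕ→ℚ (n * n)
    <⟨ ℚP.+-monoʳ-< L (ℕ→ℚ-mono-< (suc-square<4*square d 2≤d)) ⟩
      L ℚ.+ ℕ→ℚ (4 * (d * d))
    ≡⟨ cong (L ℚ.+_) (ℚP.*-identityʳ _) ⟨
      L ℚ.+ ℕ→ℚ (4 * (d * d)) ℚ.* 1ℚ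
    ≤⟨ ℚP.+-monoʳ-≤ L (ℚP.*-monoˡ-≤-nonNeg (ℕ→ℚ (4 * (d * d))) {{4d²-nonNeg}} 1≤ε²d) ⟩
      L ℚ.+ ℕ→ℚ (4 * (d * d)) ℚ.* (ε ℚ.* ε ℚ.* D)
    ≡⟨ cong (λ p → L ℚ.+ p ℚ.* (ε ℚ.* ε ℚ.* D)) (trans (ℕ→ℚ-homo-* 4 (d * d)) (cong (ℕ→ℚ 4 ℚ.*_) (ℕ→ℚ-homo-* d d))) ⟩
      L ℚ.+ ℕ→ℚ 4 ℚ.* (D ℚ.* D) ℚ.* (ε ℚ.* ε ℚ.* D)
    ≡⟨ cong (L ℚ.+_) (trans (regroup (ℕ→ℚ 4) ε D) (cong (λ c → ℕ→ℚ 4 ℚ.* (ε ℚ.* ε ℚ.* c)) (sym C≡D³))) ⟩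
      L ℚ.+ ℕ→ℚ 4 ℚ.* (ε ℚ.* ε ℚ.* C)
    ≤⟨ ℚP.+-monoʳ-≤ L (ℚP.*-monoˡ-≤-nonNeg (ℕ→ℚ 4) (ℚP.*-monoʳ-≤-nonNeg C (ℚP.*-monoʳ-≤-nonNeg ε ε≤y))) ⟩
      L ℚ.+ ℕ→ℚ 4 ℚ.* (y ℚ.* ε ℚ.* C)
    ≡⟨ squares-differ y ε C ⟩
      U
    ∎
    where
    open ℚP.≤-Reasoning
    4d²-nonNeg : ℚ.NonNegative (ℕ→ℚ (4 * (d * d)))
    4d²-nonNeg = ℚ.nonNegative (ℕ→ℚ-mono-≤ {0} {4 * (d * d)} z≤n)
    instance
      C-nonNeg : ℚ.NonNegative C
      C-nonNeg = ℚP.pos⇒nonNeg C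
      ε-nonNeg : ℚ.NonNegative ε
      ε-nonNeg = ℚP.pos⇒nonNeg ε
    cancel : ∀ y e → (y ℚ.- e) ℚ.+ e ≡ y
    cancel = solve 2 (λ y e → (y :- e) :+ e := y) refl
    ε≤y : ε ℚ.≤ y
    ε≤y = subst₂ ℚ._≤_ (ℚP.+-identityˡ ε) (cancel y ε) (ℚP.+-monoˡ-≤ ε 0≤y-ε)
    regroup : ∀ f e d → f ℚ.* (d ℚ.* d) ℚ.* (e ℚ.* e ℚ.* d)
                      ≡ f ℚ.* (e ℚ.* e ℚ.* (d ℚ.* (d ℚ.* (d ℚ.* 1ℚ))))
    regroup = solve 3 (λ f e d → f :* (d :* d) :* (e :* e :* d) := f :* (e :* e :* (d :* (d :* (d :* con 1ℚ))))) refl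
    squares-differ : ∀ y e c → (y ℚ.- e) ℚ.* (y ℚ.- e) ℚ.* c ℚ.+ ℕ→ℚ 4 ℚ.* (y ℚ.* e ℚ.* c)
                             ≡ (y ℚ.+ e) ℚ.* (y ℚ.+ e) ℚ.* c
    squares-differ = solve 3 (λ y e c → (y :- e) :* (y :- e) :* c :+ con (ℕ→ℚ 4) :* (y :* e :* c) := (y :+ e) :* (y :+ e) :* c) refl

  F-no-jump : 0ℚ ℚ.≤ y ℚ.- ε → 1ℚ ℚ.≤ ε ℚ.* ε ℚ.* D → ∀ x → F x ℚ.≤ L → F (suc x) ℚ.< U
  F-no-jump 0≤y-ε 1≤ε²d x Fx≤L = begin-strict
      F (suc x)                   ≤⟨ ℕ→ℚ-mono-≤ (sqDistAt-suc n x) ⟩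
      ℕ→ℚ (sqDistAt n x + n * n)  ≡⟨ ℕ→ℚ-homo-+ (sqDistAt n x) (n * n) ⟩
      F x ℚ.+ ℕ→ℚ (n * n)         ≤⟨ ℚP.+-monoˡ-≤ (ℕ→ℚ (n * n)) Fx≤L ⟩
      L ℚ.+ ℕ→ℚ (n * n)           <⟨ L+n²<U 0≤y-ε 1≤ε²d ⟩
      U                           ∎
    where open ℚP.≤-Reasoning

  reachable : y ℚ.≤ ½ → 1ℚ ℚ.≤ ε ℚ.* ε ℚ.* D → ∃[ x ] x ≤ n / 2 × InWindow d (sqDistAt n x) y ε
  reachable y≤½ 1≤ε²d with (y ℚ.- ε) ℚP.<? 0ℚ
  ... | yes y-ε<0 = 0 , z≤n , F0<U , inj₁ y-ε<0
  ... | no  y-ε≮0 = enter (discrete-ivt (n / 2) F F0<U (L<F-half 0≤y-ε y≤½) (F-no-jump 0≤y-ε 1≤ε²d))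
    where
    0≤y-ε : 0ℚ ℚ.≤ y ℚ.- ε
    0≤y-ε = ℚP.≮⇒≥ y-ε≮0
    enter : ∃[ x ] x ≤ n / 2 × L ℚ.< F x × F x ℚ.< U → ∃[ x ] x ≤ n / 2 × InWindow d (sqDistAt n x) y ε
    enter (x , x≤n/2 , L<Fx , Fx<U) = x , x≤n/2 , Fx<U , inj₂ L<Fx

density : (y ε : ℚ) → 0ℚ ℚ.≤ y → y ℚ.≤ ½ → Positive ε →
          ∃[ k ] ((d : ℕ) → k ≤ d → 2 ≤ d → ∃[ x ] x ≤ suc d / 2 × InWindow d (sqDistAt (suc d) x) y ε)
density y ε 0≤y y≤½ ε-pos with archimedean (ε ℚ.* ε) (ℚP.pos*pos⇒pos ε {{ε-pos}} ε {{ε-pos}})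
... | k , 1≤ε²k = k , λ d k≤d 2≤d →
  Window.reachable 2≤d 0≤y (ℚP.positive⁻¹ ε {{ε-pos}}) y≤½
    (ℚP.≤-trans 1≤ε²k (ℚP.*-monoˡ-≤-nonNeg (ε ℚ.* ε) {{ε²-nonNeg}} (ℕ→ℚ-mono-≤ k≤d)))
  where
  ε²-nonNeg : ℚ.NonNegative (ε ℚ.* ε)
  ε²-nonNeg = ℚP.nonNeg*nonNeg⇒nonNeg ε {{ℚP.pos⇒nonNeg ε {{ε-pos}}}} ε {{ℚP.pos⇒nonNeg ε {{ε-pos}}}}

proposition1 :
    ((d : ℕ) → 2 ≤ d → (s : ℕ) →
      (∃[ h ] ∃[ g ] sqDist d h g ≡ s)
        ⇔ (∃[ x ] (x ≤ suc d / 2) × (s ≡ (suc d) * x * (suc d ∸ x))))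
    × ((y ε : ℚ) → 0ℚ ≤ℚ y → y ≤ℚ ½ → Positive ε →
      ∃[ D ] ((d : ℕ) → D ≤ d → 2 ≤ d →
        ∃[ x ] (x ≤ suc d / 2) × InWindow d ((suc d) * x * (suc d ∸ x)) y ε))
proposition1 = (λ d _ → sqDist-values d) , density
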